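{- (a) If $n,m$ are both positive even integers, then $\chi'_{m\Sigma}(K_{n,m})=4$ if $n=m=2$; $\chi'_{m\Sigma}(K_{n,m})=3$ if $n=m\ge 4$; and $\chi'_{m\Sigma}(K_{n,m})=2$ if $n\ne m$. (b) If $n,m\ge 2$ and at least one of $n,m$ is odd, then $\chi'_{m\Sigma}(K_{n,m})=5$ if $n=m=3$; $\chi'_{m\Sigma}(K_{n,m})=4$ if $n=m=5$; and $\chi'_{m\Sigma}(K_{n,m})=3$ otherwise.
   Context: A $k$-edge-coloring of a graph $G$ is any map $c:E(G)\to[k]$ (adjacent edges may receive the same color). It induces $\sigma_c(v)=\sum_{u\in N(v)}c(vu)$. The coloring is neighbor sum distinguishing (NSD) if $\sigma_c(u)\ne\sigma_c(v)$ for every edge $uv$. It is majority if every vertex $v$ is incident to at most $d(v)/2$ edges of each color. $\chi'_{m\Sigma}(G)$ denotes the minimum $k$ such that $G$ has a $k$-edge-coloring that is both majority and NSD. -}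

module Defs where

open import Data.Nat using (ℕ; zero; suc; _+_; _*_; _≤_; _<_)
open import Data.Fin using (Fin; toℕ)
open import Data.Fin.Properties using (_≟_)
open import Data.Nat.ListAction using (sum)
open import Data.List using (List; map; filter; length; allFin)
open import Data.Product using (Σ; _×_)
open import Relation.Binary.PropositionalEquality using (_≡_; _≢_)
open import Relation.Nullary using (¬_)

-- The complete bipartite graph K_{n,m}: vertex set Fin n ⊎ Fin m (left part
-- Fin n, right part Fin m), and an edge between every left i and right j.
-- A k-edge-coloring c : E(K_{n,m}) → [k] = {1,…,k} is represented as
-- c : Fin n → Fin m → Fin k, where edge {i,j} gets colour 1 + toℕ (c i j).

EdgeColoring : ℕ → ℕ → ℕ → Set
EdgeColoring n m k = Fin n → Fin m → Fin k

colourValue : ∀ {k} → Fin k → ℕ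
colourValue a = suc (toℕ a)

σL : ∀ {n m k} → EdgeColoring n m k → Fin n → ℕ
σL {m = m} c i = sum (map (λ j → colourValue (c i j)) (allFin m))

σR : ∀ {n m k} → EdgeColoring n m k → Fin m → ℕ
σR {n = n} c j = sum (map (λ i → colourValue (c i j)) (allFin n))

NSD : ∀ {n m k} → EdgeColoring n m k → Set
NSD {n} {m} c = (i : Fin n) (j : Fin m) → σL c i ≢ σR c j

degColL : ∀ {n m k} → EdgeColoring n m k → Fin n → Fin k → ℕ
degColL {m = m} c i a = length (filter (λ j → c i j ≟ a) (allFin m))

degColR : ∀ {n m k} → EdgeColoring n m k → Fin m → Fin k → ℕ
degColR {n = n} c j a = length (filter (λ i → c i j ≟ a) (allFin n))

Majority : ∀ {n m k} → EdgeColoring n m k → Set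
Majority {n} {m} {k} c =
  ((i : Fin n) (a : Fin k) → 2 * degColL c i a ≤ m) ×
  ((j : Fin m) (a : Fin k) → 2 * degColR c j a ≤ n)

HasMajNSD : ℕ → ℕ → ℕ → Set
HasMajNSD n m k = Σ (EdgeColoring n m k) (λ c → Majority c × NSD c)

ChiMSigma≡ : ℕ → ℕ → ℕ → Set
ChiMSigma≡ n m k = HasMajNSD n m k × ((k' : ℕ) → k' < k → ¬ HasMajNSD n m k')

Even : ℕ → Set
Even n = Σ ℕ (λ t → n ≡ 2 * t)

Odd : ℕ → Set
Odd n = Σ ℕ (λ t → n ≡ suc (2 * t))

-- At a vertex of degree d a majority colouring uses each of its k colours at most
-- ⌊d/2⌋ times, so d ≤ k⌊d/2⌋. If d = k⌊d/2⌋ every colour is used exactly ⌊d/2⌋ times and all σ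
-- agree; this excludes 2 colours on K_{2t,2t}. If d + 1 = k⌊d/2⌋ (K_{2,2} with 3 colours, K_{3,3}
-- with 4, K_{5,5} with 3), a vertex misses the bound in exactly one colour s, and then σ equals
-- ⌊d/2⌋(1 + ⋯ + k) − s. Counting the edges of colour s shows that a row short in s is matched
-- by a column short in s, so their sums coincide. As adding an unused colour preserves
-- majority and NSD, excluding k − 1 colours excludes all smaller numbers too.
--
-- Small cases are explicit tables; K_{2s,2t} with s ≠ t is 2-coloured like a
-- chessboard (σ = 3t against 3s); when the sides differ by at least 2 the colouring (i + j) mod 3
-- has σ within 1 of twice the degree. Even squares, odd squares from K_{7,7} on, and K_{n,n+1}
-- grow by two rows and two columns whose entries over the old part alternate between the colours
-- 1 and 3: every old vertex gains 4 in σ and at most one edge of each colour, while the four new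
-- vertices are checked directly.

module Submission where

open import Defs
open import Data.Nat
  using (ℕ; zero; suc; _+_; _*_; _∸_; _≤_; _<_; z≤n; s≤s; ⌊_/2⌋; _≤?_) renaming (_≟_ to _≟ℕ_)
import Data.Nat.Properties as NP
open import Data.Nat.ListAction using () renaming (sum to listSum)
open import Data.Fin using (Fin; zero; suc; inject₁)
open import Data.Fin.Properties using (_≟_; toℕ-inject₁; all?)
open import Data.Fin.Patterns using (0F; 1F; 2F; 3F; 4F)
open import Data.List using (map; filter; length; tabulate)
open import Data.Vec using (Vec; lookup; []; _∷_)
open import Data.Vec.Functional using () renaming (_∷_ to _◂_)
open import Data.Empty using (⊥)
open import Data.Bool using (true; false; if_then_else_)
open import Data.Product using (Σ; ∃; _×_; _,_; proj₁; proj₂)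
open import Data.Sum using (_⊎_; inj₁; inj₂; reduce; swap)
open import Function using (_∘_)
open import Relation.Binary using (tri<; tri≈; tri>)
open import Relation.Binary.PropositionalEquality
open import Relation.Nullary using (¬_; Dec; does; yes; no; contradiction; ¬?)
open import Relation.Nullary.Decidable using (True; toWitness; from-yes; map′; _×-dec_)
open import Relation.Unary using (Pred; Decidable)
open import Algebra.Properties.Semiring.Sum NP.+-*-semiring
  using (sum; sum-syntax; sum-cong-≗; sum-replicate-zero; ∑-distrib-+; ∑-comm; *-distribˡ-sum)

∑-const : ∀ n c → ∑[ i < n ] c ≡ n * c
∑-const zero c = refl
∑-const (suc n) c = cong (c +_) (∑-const n c)

∑≤n*B : ∀ {n} B {f : Fin n → ℕ} → (∀ i → f i ≤ B) → sum f ≤ n * B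
∑≤n*B {zero} B le = z≤n
∑≤n*B {suc n} B le = NP.+-mono-≤ (le zero) (∑≤n*B B (le ∘ suc))

∑-split : ∀ {n} {f g h : Fin n → ℕ} → (∀ i → f i + g i ≡ h i) → sum f + sum g ≡ sum h
∑-split {f = f} {g} e = trans (sym (∑-distrib-+ f g)) (sum-cong-≗ e)

∑<n*B⇒∃<B : ∀ {n} B (f : Fin n → ℕ) → sum f < n * B → ∃ λ i → f i < B
∑<n*B⇒∃<B {zero} B f ()
∑<n*B⇒∃<B {suc n} B f lt with suc (f zero) ≤? B
... | yes f₀<B = zero , f₀<B
... | no f₀≮B
  with ∑<n*B⇒∃<B B (f ∘ suc) (NP.+-cancelˡ-< B _ _ (NP.≤-<-trans (NP.+-monoˡ-≤ _ (NP.≮⇒≥ f₀≮B)) lt))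
...   | i , fᵢ<B = suc i , fᵢ<B

m+n≡1⇒m≡0∧n≡1⊎m≡1∧n≡0 : ∀ m n → m + n ≡ 1 → (m ≡ 0 × n ≡ 1) ⊎ (m ≡ 1 × n ≡ 0)
m+n≡1⇒m≡0∧n≡1⊎m≡1∧n≡0 zero n e = inj₁ (refl , e)
m+n≡1⇒m≡0∧n≡1⊎m≡1∧n≡0 (suc zero) zero e = inj₂ (refl , refl)

∑≡0⇒≡0 : ∀ {n} (f : Fin n → ℕ) → sum f ≡ 0 → ∀ i → f i ≡ 0
∑≡0⇒≡0 f e zero = NP.m+n≡0⇒m≡0 (f zero) e
∑≡0⇒≡0 f e (suc i) = ∑≡0⇒≡0 (f ∘ suc) (NP.m+n≡0⇒n≡0 (f zero) e) i

∑≡0⇒weighted∑≡0 : ∀ {n} (w f : Fin n → ℕ) → sum f ≡ 0 → ∑[ i < n ] (w i * f i) ≡ 0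
∑≡0⇒weighted∑≡0 {n} w f e = begin
  ∑[ i < n ] (w i * f i) ≡⟨ sum-cong-≗ (λ i → trans (cong (w i *_) (∑≡0⇒≡0 f e i)) (NP.*-zeroʳ (w i))) ⟩
  ∑[ i < n ] 0         ≡⟨ sum-replicate-zero n ⟩
  0                    ∎
  where open ≡-Reasoning

∑≡1⇒weighted∑≡weight : ∀ {n} (w f : Fin n → ℕ) {s} → sum f ≡ 1 → 0 < f s → ∑[ i < n ] (w i * f i) ≡ w s
∑≡1⇒weighted∑≡weight w f {zero} e pos with m+n≡1⇒m≡0∧n≡1⊎m≡1∧n≡0 (f zero) (sum (f ∘ suc)) e
... | inj₁ (f₀≡0 , _) = contradiction f₀≡0 (NP.n>0⇒n≢0 pos)
... | inj₂ (f₀≡1 , rest≡0) =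
  trans (cong₂ _+_ (trans (cong (w zero *_) f₀≡1) (NP.*-identityʳ (w zero)))
                   (∑≡0⇒weighted∑≡0 (w ∘ suc) (f ∘ suc) rest≡0))
        (NP.+-identityʳ (w zero))
∑≡1⇒weighted∑≡weight w f {suc s} e pos with m+n≡1⇒m≡0∧n≡1⊎m≡1∧n≡0 (f zero) (sum (f ∘ suc)) e
... | inj₁ (f₀≡0 , rest≡1) =
  cong₂ _+_ (trans (cong (w zero *_) f₀≡0) (NP.*-zeroʳ (w zero)))
            (∑≡1⇒weighted∑≡weight (w ∘ suc) (f ∘ suc) rest≡1 pos)
... | inj₂ (_ , rest≡0) = contradiction (∑≡0⇒≡0 (f ∘ suc) rest≡0 s) (NP.n>0⇒n≢0 pos)

-- A vertex of degree d is represented by the line of colours on its d edges.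

Line : ℕ → ℕ → Set
Line d k = Fin d → Fin k

δ : ∀ {k} → Fin k → Fin k → ℕ
δ x a = if does (x ≟ a) then 1 else 0

σ : ∀ {d k} → Line d k → ℕ
σ {d} f = ∑[ j < d ] colourValue (f j)

count : ∀ {d k} → Line d k → Fin k → ℕ
count {d} f a = ∑[ j < d ] δ (f j) a

Balanced : ∀ {d k} → Line d k → Set
Balanced {d} f = ∀ a → 2 * count f a ≤ d

column : ∀ {n m k} → EdgeColoring n m k → Fin m → Line n k
column c j i = c i j

record IsMajNSD {n m k} (c : EdgeColoring n m k) : Set where
  field
    rows-balanced    : ∀ i → Balanced (c i)
    columns-balanced : ∀ j → Balanced (column c j)
    σ-distinct       : ∀ i j → σ (c i) ≢ σ (column c j)

listSum-map-tabulate : ∀ {n} {A : Set} (f : A → ℕ) (g : Fin n → A) →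
  listSum (map f (tabulate g)) ≡ ∑[ i < n ] f (g i)
listSum-map-tabulate {zero} f g = refl
listSum-map-tabulate {suc n} f g = cong (f (g zero) +_) (listSum-map-tabulate f (g ∘ suc))

length-filter-tabulate : ∀ {n} {A : Set} {p} {P : Pred A p} (P? : Decidable P) (g : Fin n → A) →
  length (filter P? (tabulate g)) ≡ ∑[ i < n ] (if does (P? (g i)) then 1 else 0)
length-filter-tabulate {zero} P? g = refl
length-filter-tabulate {suc n} P? g with does (P? (g zero))
... | true = cong suc (length-filter-tabulate P? (g ∘ suc))
... | false = length-filter-tabulate P? (g ∘ suc)

module _ {n m k} {c : EdgeColoring n m k} where

  degColL≡count : ∀ i a → degColL c i a ≡ count (c i) a
  degColL≡count i a = length-filter-tabulate (λ j → c i j ≟ a) (λ j → j)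

  degColR≡count : ∀ j a → degColR c j a ≡ count (column c j) a
  degColR≡count j a = length-filter-tabulate (λ i → c i j ≟ a) (λ i → i)

  σL≡σ : ∀ i → σL c i ≡ σ (c i)
  σL≡σ i = listSum-map-tabulate (λ j → colourValue (c i j)) (λ j → j)

  σR≡σ : ∀ j → σR c j ≡ σ (column c j)
  σR≡σ j = listSum-map-tabulate (λ i → colourValue (c i j)) (λ i → i)

  IsMajNSD⇒HasMajNSD : IsMajNSD c → HasMajNSD n m k
  IsMajNSD⇒HasMajNSD good = c , (rows , columns) , distinct
    where
    open IsMajNSD good
    rows : ∀ i a → 2 * degColL c i a ≤ m
    rows i a rewrite degColL≡count i a = rows-balanced i a
    columns : ∀ j a → 2 * degColR c j a ≤ n
    columns j a rewrite degColR≡count j a = columns-balanced j a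
    distinct : NSD c
    distinct i j rewrite σL≡σ i | σR≡σ j = σ-distinct i j

HasMajNSD⇒IsMajNSD : ∀ {n m k} → HasMajNSD n m k → Σ (EdgeColoring n m k) IsMajNSD
HasMajNSD⇒IsMajNSD {n} {m} (c , (rows , columns) , distinct) = c , record
  { rows-balanced    = λ i a → subst (λ x → 2 * x ≤ m) (degColL≡count {c = c} i a) (rows i a)
  ; columns-balanced = λ j a → subst (λ x → 2 * x ≤ n) (degColR≡count {c = c} j a) (columns j a)
  ; σ-distinct       = λ i j → subst₂ _≢_ (σL≡σ {c = c} i) (σR≡σ {c = c} j) (distinct i j)
  }

transpose : ∀ {n m k} → EdgeColoring n m k → EdgeColoring m n k
transpose c j i = c i j

HasMajNSD-transpose : ∀ {n m k} → HasMajNSD n m k → HasMajNSD m n k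
HasMajNSD-transpose (c , (rows , columns) , distinct) =
  transpose c , (columns , rows) , λ j i e → distinct i j (sym e)

δ-inject₁ : ∀ {k} (a : Fin (suc k)) →
  (∀ (x : Fin k) → δ (inject₁ x) a ≡ 0) ⊎ (∃ λ a′ → ∀ x → δ (inject₁ x) a ≡ δ x a′)
δ-inject₁ {zero} a = inj₁ λ ()
δ-inject₁ {suc k} zero = inj₂ (zero , λ { zero → refl ; (suc x) → refl })
δ-inject₁ {suc k} (suc a) with δ-inject₁ a
... | inj₁ never = inj₁ λ { zero → refl ; (suc x) → never x }
... | inj₂ (a′ , same) = inj₂ (suc a′ , λ { zero → refl ; (suc x) → same x })

module _ {d k} (f : Line d k) where

  Balanced-inject₁ : Balanced f → Balanced (inject₁ ∘ f)
  Balanced-inject₁ balanced a with δ-inject₁ a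
  ... | inj₁ never rewrite sum-cong-≗ (never ∘ f) | ∑-const d 0 | NP.*-zeroʳ d = z≤n
  ... | inj₂ (a′ , same) rewrite sum-cong-≗ (same ∘ f) = balanced a′

  σ-inject₁ : σ (inject₁ ∘ f) ≡ σ f
  σ-inject₁ = sum-cong-≗ (cong suc ∘ toℕ-inject₁ ∘ f)

HasMajNSD-suc : ∀ {n m k} → HasMajNSD n m k → HasMajNSD n m (suc k)
HasMajNSD-suc h with HasMajNSD⇒IsMajNSD h
... | c , good = IsMajNSD⇒HasMajNSD record
  { rows-balanced    = λ i → Balanced-inject₁ (c i) (rows-balanced i)
  ; columns-balanced = λ j → Balanced-inject₁ (column c j) (columns-balanced j)
  ; σ-distinct       = λ i j → subst₂ _≢_ (sym (σ-inject₁ (c i))) (sym (σ-inject₁ (column c j)))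
                                  (σ-distinct i j)
  }
  where open IsMajNSD good

HasMajNSD-mono : ∀ {n m k′ k} → k′ ≤ k → HasMajNSD n m k′ → HasMajNSD n m k
HasMajNSD-mono {k = zero} z≤n h = h
HasMajNSD-mono {k = suc k} k′≤1+k h with NP.m≤n⇒m<n∨m≡n k′≤1+k
... | inj₁ k′<1+k = HasMajNSD-suc (HasMajNSD-mono (NP.≤-pred k′<1+k) h)
... | inj₂ refl = h

ChiMSigma≡-intro : ∀ {n m k} → HasMajNSD n m (suc k) → ¬ HasMajNSD n m k → ChiMSigma≡ n m (suc k)
ChiMSigma≡-intro has none = has , λ k′ k′<1+k h → none (HasMajNSD-mono (NP.≤-pred k′<1+k) h)

-- Lower bounds

∑-weighted-δ : ∀ {k} (w : Fin k → ℕ) (x : Fin k) → ∑[ a < k ] (w a * δ x a) ≡ w x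
∑-weighted-δ {suc k} w zero =
  trans (cong₂ _+_ (NP.*-identityʳ (w zero))
                   (∑≡0⇒weighted∑≡0 (w ∘ suc) (λ _ → 0) (sum-replicate-zero k)))
        (NP.+-identityʳ (w zero))
∑-weighted-δ {suc k} w (suc x) = cong₂ _+_ (NP.*-zeroʳ (w zero)) (∑-weighted-δ (w ∘ suc) x)

2*m≤n⇒m≤⌊n/2⌋ : ∀ {m n} → 2 * m ≤ n → m ≤ ⌊ n /2⌋
2*m≤n⇒m≤⌊n/2⌋ {m} {n} 2m≤n = begin
  m           ≡⟨ NP.n≡⌊n+n/2⌋ m ⟩
  ⌊ m + m /2⌋ ≡⟨ cong (λ x → ⌊ m + x /2⌋) (sym (NP.+-identityʳ m)) ⟩
  ⌊ 2 * m /2⌋ ≤⟨ NP.⌊n/2⌋-mono 2m≤n ⟩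
  ⌊ n /2⌋     ∎
  where open NP.≤-Reasoning

module _ {d k} (f : Line d k) where

  ∑-weighted-count : (w : Fin k → ℕ) → ∑[ a < k ] (w a * count f a) ≡ ∑[ j < d ] w (f j)
  ∑-weighted-count w = begin
    ∑[ a < k ] (w a * count f a)          ≡⟨ sum-cong-≗ (λ a → *-distribˡ-sum (w a) (λ j → δ (f j) a)) ⟩
    ∑[ a < k ] ∑[ j < d ] (w a * δ (f j) a) ≡⟨ ∑-comm (λ a j → w a * δ (f j) a) ⟩
    ∑[ j < d ] ∑[ a < k ] (w a * δ (f j) a) ≡⟨ sum-cong-≗ (λ j → ∑-weighted-δ w (f j)) ⟩
    ∑[ j < d ] w (f j)                     ∎
    where open ≡-Reasoning

  ∑-count : ∑[ a < k ] count f a ≡ d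
  ∑-count = begin
    ∑[ a < k ] count f a       ≡⟨ sum-cong-≗ (λ a → sym (NP.*-identityˡ (count f a))) ⟩
    ∑[ a < k ] (1 * count f a) ≡⟨ ∑-weighted-count (λ _ → 1) ⟩
    ∑[ j < d ] 1               ≡⟨ ∑-const d 1 ⟩
    d * 1                      ≡⟨ NP.*-identityʳ d ⟩
    d                          ∎
    where open ≡-Reasoning

  slack : Fin k → ℕ
  slack a = ⌊ d /2⌋ ∸ count f a

  module _ (balanced : Balanced f) where

    count≤⌊d/2⌋ : ∀ a → count f a ≤ ⌊ d /2⌋
    count≤⌊d/2⌋ a = 2*m≤n⇒m≤⌊n/2⌋ (balanced a)

    length≤k*⌊length/2⌋ : d ≤ k * ⌊ d /2⌋
    length≤k*⌊length/2⌋ = subst (_≤ k * ⌊ d /2⌋) ∑-count (∑≤n*B ⌊ d /2⌋ count≤⌊d/2⌋)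

    count+slack : ∀ a → count f a + slack a ≡ ⌊ d /2⌋
    count+slack a = NP.m+[n∸m]≡n (count≤⌊d/2⌋ a)

    length+∑slack : d + sum slack ≡ k * ⌊ d /2⌋
    length+∑slack = trans (cong (_+ sum slack) (sym ∑-count)) (trans (∑-split count+slack) (∑-const k _))

    σ+weighted-slack : σ f + ∑[ a < k ] (colourValue a * slack a) ≡ ∑[ a < k ] (colourValue a * ⌊ d /2⌋)
    σ+weighted-slack = begin
      σ f + ∑[ a < k ] (colourValue a * slack a)
        ≡⟨ cong (_+ ∑[ a < k ] (colourValue a * slack a)) (sym (∑-weighted-count colourValue)) ⟩
      ∑[ a < k ] (colourValue a * count f a) + ∑[ a < k ] (colourValue a * slack a)
        ≡⟨ ∑-split (λ a → trans (sym (NP.*-distribˡ-+ (colourValue a) (count f a) (slack a)))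
                                (cong (colourValue a *_) (count+slack a))) ⟩
      ∑[ a < k ] (colourValue a * ⌊ d /2⌋) ∎
      where open ≡-Reasoning

    σ-when-tight : d ≡ k * ⌊ d /2⌋ → σ f ≡ ∑[ a < k ] (colourValue a * ⌊ d /2⌋)
    σ-when-tight tight = begin
      σ f                                       ≡⟨ sym (NP.+-identityʳ (σ f)) ⟩
      σ f + 0                                   ≡⟨ cong (σ f +_) (sym (∑≡0⇒weighted∑≡0 colourValue slack no-slack)) ⟩
      σ f + ∑[ a < k ] (colourValue a * slack a) ≡⟨ σ+weighted-slack ⟩
      ∑[ a < k ] (colourValue a * ⌊ d /2⌋)       ∎
      where
      open ≡-Reasoning
      no-slack : sum slack ≡ 0
      no-slack = NP.+-cancelˡ-≡ d _ _ (trans length+∑slack (trans (sym tight) (sym (NP.+-identityʳ d))))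

    σ-when-one-short : suc d ≡ k * ⌊ d /2⌋ → ∀ {s} → count f s < ⌊ d /2⌋ →
                       σ f + colourValue s ≡ ∑[ a < k ] (colourValue a * ⌊ d /2⌋)
    σ-when-one-short short {s} s-short = begin
      σ f + colourValue s                       ≡⟨ cong (σ f +_) (sym (∑≡1⇒weighted∑≡weight colourValue slack
                                                     one-slack (NP.m<n⇒0<n∸m s-short))) ⟩
      σ f + ∑[ a < k ] (colourValue a * slack a) ≡⟨ σ+weighted-slack ⟩
      ∑[ a < k ] (colourValue a * ⌊ d /2⌋)       ∎
      where
      open ≡-Reasoning
      one-slack : sum slack ≡ 1
      one-slack = NP.+-cancelˡ-≡ d _ _ (trans length+∑slack (trans (sym short) (NP.+-comm 1 d)))


¬IsMajNSD⇒¬HasMajNSD : ∀ {n m k} → (∀ (c : EdgeColoring n m k) → ¬ IsMajNSD c) → ¬ HasMajNSD n m k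
¬IsMajNSD⇒¬HasMajNSD none h = none (proj₁ (HasMajNSD⇒IsMajNSD h)) (proj₂ (HasMajNSD⇒IsMajNSD h))

¬HasMajNSD-few-colours : ∀ {n m k} → k * ⌊ m /2⌋ < m → ¬ HasMajNSD (suc n) m k
¬HasMajNSD-few-colours few = ¬IsMajNSD⇒¬HasMajNSD λ c good →
  NP.<⇒≱ few (length≤k*⌊length/2⌋ (c zero) (IsMajNSD.rows-balanced good zero))

module _ {d k} (c : EdgeColoring (suc d) (suc d) k) (good : IsMajNSD c) where
  open IsMajNSD good

  ¬IsMajNSD-tight : suc d ≡ k * ⌊ suc d /2⌋ → ⊥
  ¬IsMajNSD-tight tight = σ-distinct zero zero (trans
    (σ-when-tight (c zero) (rows-balanced zero) tight)
    (sym (σ-when-tight (column c zero) (columns-balanced zero) tight)))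

  ¬IsMajNSD-one-short : suc (suc d) ≡ k * ⌊ suc d /2⌋ → ⊥
  ¬IsMajNSD-one-short short =
    σ-distinct zero j (NP.+-cancelʳ-≡ (colourValue s) _ _ (trans
      (σ-when-one-short (c zero) (rows-balanced zero) short s-short-in-row)
      (sym (σ-when-one-short (column c j) (columns-balanced j) short s-short-in-column))))
    where
    B = ⌊ suc d /2⌋
    row-short = ∑<n*B⇒∃<B B (count (c zero)) (subst (_< k * B) (sym (∑-count (c zero))) (NP.≤-reflexive short))
    s = proj₁ row-short
    s-short-in-row = proj₂ row-short
    total-s : ∑[ i < suc d ] count (c i) s < suc d * B
    total-s = NP.+-mono-≤ s-short-in-row
      (∑≤n*B B λ i → count≤⌊d/2⌋ (c (suc i)) (rows-balanced (suc i)) s)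
    column-short = ∑<n*B⇒∃<B B (λ j → count (column c j) s)
      (subst (_< suc d * B) (∑-comm (λ i j → δ (c i j) s)) total-s)
    j = proj₁ column-short
    s-short-in-column = proj₂ column-short

¬HasMajNSD-tight : ∀ {d k} → suc d ≡ k * ⌊ suc d /2⌋ → ¬ HasMajNSD (suc d) (suc d) k
¬HasMajNSD-tight tight = ¬IsMajNSD⇒¬HasMajNSD λ c good → ¬IsMajNSD-tight c good tight

¬HasMajNSD-one-short : ∀ {d k} → suc (suc d) ≡ k * ⌊ suc d /2⌋ → ¬ HasMajNSD (suc d) (suc d) k
¬HasMajNSD-one-short short = ¬IsMajNSD⇒¬HasMajNSD λ c good → ¬IsMajNSD-one-short c good short

fromTable : ∀ {n m k} → Vec (Vec (Fin k) m) n → EdgeColoring n m k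
fromTable T i j = lookup (lookup T i) j

balanced? : ∀ {d k} (f : Line d k) → Dec (Balanced f)
balanced? {d} f = all? λ a → 2 * count f a ≤? d

isMajNSD? : ∀ {n m k} (c : EdgeColoring n m k) → Dec (IsMajNSD c)
isMajNSD? c = map′
  (λ (rows , columns , distinct) → record
    { rows-balanced = rows ; columns-balanced = columns ; σ-distinct = distinct })
  (λ good → let open IsMajNSD good in rows-balanced , columns-balanced , σ-distinct)
  (all? (balanced? ∘ c) ×-dec all? (balanced? ∘ column c) ×-dec
   all? λ i → all? λ j → ¬? (σ (c i) ≟ℕ σ (column c j)))

HasMajNSD-fromTable : ∀ {n m k} (T : Vec (Vec (Fin k) m) n) → {True (isMajNSD? (fromTable T))} →
  HasMajNSD n m k
HasMajNSD-fromTable T {yes!} = IsMajNSD⇒HasMajNSD (toWitness yes!)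

hasMajNSD-2-2-4 : HasMajNSD 2 2 4
hasMajNSD-2-2-4 = HasMajNSD-fromTable
  ((0F ∷ 2F ∷ []) ∷
   (1F ∷ 3F ∷ []) ∷ [])

hasMajNSD-3-3-5 : HasMajNSD 3 3 5
hasMajNSD-3-3-5 = HasMajNSD-fromTable
  ((1F ∷ 0F ∷ 2F ∷ []) ∷
   (3F ∷ 2F ∷ 4F ∷ []) ∷
   (0F ∷ 4F ∷ 1F ∷ []) ∷ [])

hasMajNSD-5-5-4 : HasMajNSD 5 5 4
hasMajNSD-5-5-4 = HasMajNSD-fromTable
  ((3F ∷ 0F ∷ 1F ∷ 2F ∷ 0F ∷ []) ∷
   (1F ∷ 2F ∷ 1F ∷ 0F ∷ 2F ∷ []) ∷
   (1F ∷ 3F ∷ 2F ∷ 1F ∷ 3F ∷ []) ∷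
   (2F ∷ 3F ∷ 3F ∷ 1F ∷ 1F ∷ []) ∷
   (0F ∷ 1F ∷ 0F ∷ 3F ∷ 1F ∷ []) ∷ [])

hasMajNSD-3-2-3 : HasMajNSD 3 2 3
hasMajNSD-3-2-3 = HasMajNSD-fromTable
  ((2F ∷ 0F ∷ []) ∷
   (0F ∷ 1F ∷ []) ∷
   (1F ∷ 2F ∷ []) ∷ [])

-- Bordering a colouring by two rows and two columns

double : ℕ → ℕ
double zero = zero
double (suc t) = suc (suc (double t))

2*m≤double : ∀ {m} t → m ≤ t → 2 * m ≤ double t
2*m≤double {zero} t _ = z≤n
2*m≤double {suc m} (suc t) (s≤s m≤t) rewrite NP.+-suc m (m + 0) = s≤s (s≤s (2*m≤double t m≤t))

2*m≤1+double : ∀ {m} t → m ≤ t → 2 * m ≤ suc (double t)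
2*m≤1+double t m≤t = NP.m≤n⇒m≤1+n (2*m≤double t m≤t)

alternate : ∀ {n k} → Fin k → Fin k → Line n k
alternate x y zero = x
alternate x y (suc j) = alternate y x j

∑-alternate : ∀ {k} t (g : Fin k → ℕ) x y → ∑[ j < double t ] g (alternate x y j) ≡ t * (g x + g y)
∑-alternate zero g x y = refl
∑-alternate (suc t) g x y rewrite ∑-alternate t g x y = sym (NP.+-assoc (g x) (g y) _)

alternate-swap-+ : ∀ {n k} (g : Fin k → ℕ) x y (i : Fin n) → g (alternate x y i) + g (alternate y x i) ≡ g x + g y
alternate-swap-+ g x y zero = refl
alternate-swap-+ g x y (suc i) = trans (alternate-swap-+ g y x i) (NP.+-comm (g y) (g x))

alternate-swap-≢ : ∀ {n k} {x y : Fin k} → x ≢ y → (i : Fin n) → alternate x y i ≢ alternate y x i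
alternate-swap-≢ x≢y zero = x≢y
alternate-swap-≢ x≢y (suc i) = alternate-swap-≢ (x≢y ∘ sym) i

δ+δ≤1 : ∀ {k} {x y : Fin k} (a : Fin k) → x ≢ y → δ x a + δ y a ≤ 1
δ+δ≤1 {x = x} {y} a x≢y with x ≟ a | y ≟ a
... | yes x≡a | yes y≡a = contradiction (trans x≡a (sym y≡a)) x≢y
... | yes _ | no _ = s≤s z≤n
... | no _ | yes _ = s≤s z≤n
... | no _ | no _ = z≤n

border : ∀ {n m k} → EdgeColoring n m k → (u₀ u₁ : Line n k) (r₀ r₁ : Line m k) (x₀₀ x₀₁ x₁₀ x₁₁ : Fin k) →
         EdgeColoring (suc (suc n)) (suc (suc m)) k
border M u₀ u₁ r₀ r₁ x₀₀ x₀₁ x₁₀ x₁₁ 0F 0F = x₀₀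
border M u₀ u₁ r₀ r₁ x₀₀ x₀₁ x₁₀ x₁₁ 0F 1F = x₀₁
border M u₀ u₁ r₀ r₁ x₀₀ x₀₁ x₁₀ x₁₁ 0F (suc (suc j)) = r₀ j
border M u₀ u₁ r₀ r₁ x₀₀ x₀₁ x₁₀ x₁₁ 1F 0F = x₁₀
border M u₀ u₁ r₀ r₁ x₀₀ x₀₁ x₁₀ x₁₁ 1F 1F = x₁₁
border M u₀ u₁ r₀ r₁ x₀₀ x₀₁ x₁₀ x₁₁ 1F (suc (suc j)) = r₁ j
border M u₀ u₁ r₀ r₁ x₀₀ x₀₁ x₁₀ x₁₁ (suc (suc i)) 0F = u₀ i
border M u₀ u₁ r₀ r₁ x₀₀ x₀₁ x₁₀ x₁₁ (suc (suc i)) 1F = u₁ i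
border M u₀ u₁ r₀ r₁ x₀₀ x₀₁ x₁₀ x₁₁ (suc (suc i)) (suc (suc j)) = M i j

σ-old-line : ∀ {n k} (x y : Fin k) (i : Fin n) {X Y} → X ≡ Y →
  colourValue (alternate x y i) + (colourValue (alternate y x i) + X) ≡ (colourValue x + colourValue y) + Y
σ-old-line x y i {X} refl = trans (sym (NP.+-assoc (colourValue (alternate x y i)) _ X))
                                  (cong (_+ X) (alternate-swap-+ colourValue x y i))

count-old-line : ∀ {n k t} {x y : Fin k} → x ≢ y → (i : Fin n) (a : Fin k) {r : ℕ} → r ≤ t →
  δ (alternate x y i) a + (δ (alternate y x i) a + r) ≤ suc t
count-old-line {t = t} {x} {y} x≢y i a {r} r≤t = subst (_≤ suc t) (NP.+-assoc (δ (alternate x y i) a) _ r)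
  (NP.+-mono-≤ (δ+δ≤1 a (alternate-swap-≢ x≢y i)) r≤t)

-- Once the colour is fixed, a count at a new line of a border normalises to p + t * c for numerals p, c.
count-new-line-absent : ∀ t p → p ≤ suc t → p + t * 0 ≤ suc t
count-new-line-absent t p p≤1+t rewrite NP.*-zeroʳ t | NP.+-identityʳ p = p≤1+t

count-new-line-present : ∀ t p → p ≤ 1 → p + t * 1 ≤ suc t
count-new-line-present t p p≤1 rewrite NP.*-identityʳ t = NP.+-monoˡ-≤ t p≤1

m≢n⇒m+o≢n+o : ∀ {m n} o → m ≢ n → m + o ≢ n + o
m≢n⇒m+o≢n+o o m≢n e = m≢n (NP.+-cancelʳ-≡ o _ _ e)

record EvenSquareInvariant t (c : EdgeColoring (double t) (double t) 3) : Set where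
  field
    row-σ        : ∀ i → σ (c i) ≡ t * 4
    column-σ     : ∀ j → σ (column c j) ≢ t * 4
    row-count    : ∀ i a → count (c i) a ≤ t
    column-count : ∀ j a → count (column c j) a ≤ t

evenSquareBorder : ∀ {t} → EdgeColoring (double t) (double t) 3 → EdgeColoring (double (suc t)) (double (suc t)) 3
evenSquareBorder c = border c (alternate 2F 0F) (alternate 0F 2F) (alternate 2F 0F) (alternate 0F 2F) 2F 0F 1F 1F

evenSquareBorder-invariant : ∀ t (c : EdgeColoring (double t) (double t) 3) → 1 ≤ t →
  EvenSquareInvariant t c → EvenSquareInvariant (suc t) (evenSquareBorder c)
evenSquareBorder-invariant t c 1≤t inv = record
  { row-σ = row-σ′ ; column-σ = column-σ′ ; row-count = row-count′ ; column-count = column-count′ }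
  where
  open EvenSquareInvariant inv
  c′ = evenSquareBorder c
  row-σ′ : ∀ i → σ (c′ i) ≡ suc t * 4
  row-σ′ 0F = cong (λ z → 3 + (1 + z)) (∑-alternate t colourValue 2F 0F)
  row-σ′ 1F = cong (λ z → 2 + (2 + z)) (∑-alternate t colourValue 0F 2F)
  row-σ′ (suc (suc i)) = σ-old-line 2F 0F i (row-σ i)
  column-σ′ : ∀ j → σ (column c′ j) ≢ suc t * 4
  column-σ′ 0F e = m≢n⇒m+o≢n+o {5} {4} (t * 4) (λ ())
    (trans (sym (cong (λ z → 3 + (2 + z)) (∑-alternate t colourValue 2F 0F))) e)
  column-σ′ 1F e = m≢n⇒m+o≢n+o {3} {4} (t * 4) (λ ())
    (trans (sym (cong (λ z → 1 + (2 + z)) (∑-alternate t colourValue 0F 2F))) e)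
  column-σ′ (suc (suc j)) e = column-σ j (NP.+-cancelˡ-≡ 4 _ _ (trans (sym (σ-old-line 2F 0F j refl)) e))
  row-count′ : ∀ i a → count (c′ i) a ≤ suc t
  row-count′ 0F a rewrite ∑-alternate t (λ z → δ z a) 2F 0F = new a
    where
    new : ∀ a → δ 2F a + (δ 0F a + t * (δ 2F a + δ 0F a)) ≤ suc t
    new 0F = count-new-line-present t 1 NP.≤-refl
    new 1F = count-new-line-absent t 0 z≤n
    new 2F = count-new-line-present t 1 NP.≤-refl
  row-count′ 1F a rewrite ∑-alternate t (λ z → δ z a) 0F 2F = new a
    where
    new : ∀ a → δ 1F a + (δ 1F a + t * (δ 0F a + δ 2F a)) ≤ suc t
    new 0F = count-new-line-present t 0 z≤n
    new 1F = count-new-line-absent t 2 (s≤s 1≤t)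
    new 2F = count-new-line-present t 0 z≤n
  row-count′ (suc (suc i)) a = count-old-line (λ ()) i a (row-count i a)
  column-count′ : ∀ j a → count (column c′ j) a ≤ suc t
  column-count′ 0F a rewrite ∑-alternate t (λ z → δ z a) 2F 0F = new a
    where
    new : ∀ a → δ 2F a + (δ 1F a + t * (δ 2F a + δ 0F a)) ≤ suc t
    new 0F = count-new-line-present t 0 z≤n
    new 1F = count-new-line-absent t 1 (s≤s z≤n)
    new 2F = count-new-line-present t 1 NP.≤-refl
  column-count′ 1F a rewrite ∑-alternate t (λ z → δ z a) 0F 2F = new a
    where
    new : ∀ a → δ 0F a + (δ 1F a + t * (δ 0F a + δ 2F a)) ≤ suc t
    new 0F = count-new-line-present t 1 NP.≤-refl
    new 1F = count-new-line-absent t 1 (s≤s z≤n)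
    new 2F = count-new-line-present t 0 z≤n
  column-count′ (suc (suc j)) a = count-old-line (λ ()) j a (column-count j a)

evenSquare-4 : EdgeColoring 4 4 3
evenSquare-4 = fromTable
  ((1F ∷ 2F ∷ 1F ∷ 0F ∷ []) ∷
   (0F ∷ 0F ∷ 2F ∷ 2F ∷ []) ∷
   (0F ∷ 2F ∷ 1F ∷ 1F ∷ []) ∷
   (1F ∷ 1F ∷ 2F ∷ 0F ∷ []) ∷ [])

evenSquare-4-invariant : EvenSquareInvariant 2 evenSquare-4
evenSquare-4-invariant = record
  { row-σ        = from-yes (all? λ i → σ (evenSquare-4 i) ≟ℕ 8)
  ; column-σ     = from-yes (all? λ j → ¬? (σ (column evenSquare-4 j) ≟ℕ 8))
  ; row-count    = from-yes (all? λ i → all? λ a → count (evenSquare-4 i) a ≤? 2)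
  ; column-count = from-yes (all? λ j → all? λ a → count (column evenSquare-4 j) a ≤? 2)
  }

evenSquare : ∀ t → Σ (EdgeColoring (double (2 + t)) (double (2 + t)) 3) (EvenSquareInvariant (2 + t))
evenSquare zero = evenSquare-4 , evenSquare-4-invariant
evenSquare (suc t) with evenSquare t
... | c , inv = evenSquareBorder c , evenSquareBorder-invariant (2 + t) c (s≤s z≤n) inv

EvenSquareInvariant⇒IsMajNSD : ∀ {t c} → EvenSquareInvariant t c → IsMajNSD c
EvenSquareInvariant⇒IsMajNSD {t} inv = record
  { rows-balanced    = λ i a → 2*m≤double t (row-count i a)
  ; columns-balanced = λ j a → 2*m≤double t (column-count j a)
  ; σ-distinct       = λ i j e → column-σ j (trans (sym e) (row-σ i))
  }
  where open EvenSquareInvariant inv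

hasMajNSD-evenSquare : ∀ t → HasMajNSD (double (2 + t)) (double (2 + t)) 3
hasMajNSD-evenSquare t = IsMajNSD⇒HasMajNSD (EvenSquareInvariant⇒IsMajNSD (proj₂ (evenSquare t)))

m*4≢2+n*4 : ∀ m n → m * 4 ≢ suc (suc (n * 4))
m*4≢2+n*4 zero n ()
m*4≢2+n*4 (suc m) zero ()
m*4≢2+n*4 (suc m) (suc n) e = m*4≢2+n*4 m n (NP.+-cancelˡ-≡ 4 _ _ e)

record OddEvenInvariant a b (c : EdgeColoring (suc (double a)) (double b) 3) : Set where
  field
    row-σ        : ∀ i → σ (c i) ≡ b * 4
    column-σ     : ∀ j → σ (column c j) ≡ 2 + a * 4
    row-count    : ∀ i x → count (c i) x ≤ b
    column-count : ∀ j x → count (column c j) x ≤ a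

oddEvenBorder : ∀ {a b} → EdgeColoring (suc (double a)) (double b) 3 →
                EdgeColoring (suc (double (suc a))) (double (suc b)) 3
oddEvenBorder c = border c (alternate 2F 0F) (alternate 0F 2F) (alternate 2F 0F) (alternate 0F 2F) 1F 1F 0F 2F

oddEvenBorder-invariant : ∀ a b (c : EdgeColoring (suc (double a)) (double b) 3) → 1 ≤ b →
  OddEvenInvariant a b c → OddEvenInvariant (suc a) (suc b) (oddEvenBorder c)
oddEvenBorder-invariant a b c 1≤b inv = record
  { row-σ = row-σ′ ; column-σ = column-σ′ ; row-count = row-count′ ; column-count = column-count′ }
  where
  open OddEvenInvariant inv
  c′ = oddEvenBorder c
  row-σ′ : ∀ i → σ (c′ i) ≡ suc b * 4
  row-σ′ 0F = cong (λ z → 2 + (2 + z)) (∑-alternate b colourValue 2F 0F)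
  row-σ′ 1F = cong (λ z → 1 + (3 + z)) (∑-alternate b colourValue 0F 2F)
  row-σ′ (suc (suc i)) = σ-old-line 2F 0F i (row-σ i)
  column-σ′ : ∀ j → σ (column c′ j) ≡ 2 + suc a * 4
  column-σ′ 0F = cong (λ z → 2 + (1 + (3 + z))) (∑-alternate a colourValue 0F 2F)
  column-σ′ 1F = cong (λ z → 2 + (3 + (1 + z))) (∑-alternate a colourValue 2F 0F)
  column-σ′ (suc (suc j)) = σ-old-line 2F 0F j (column-σ j)
  row-count′ : ∀ i x → count (c′ i) x ≤ suc b
  row-count′ 0F x rewrite ∑-alternate b (λ z → δ z x) 2F 0F = new x
    where
    new : ∀ x → δ 1F x + (δ 1F x + b * (δ 2F x + δ 0F x)) ≤ suc b
    new 0F = count-new-line-present b 0 z≤n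
    new 1F = count-new-line-absent b 2 (s≤s 1≤b)
    new 2F = count-new-line-present b 0 z≤n
  row-count′ 1F x rewrite ∑-alternate b (λ z → δ z x) 0F 2F = new x
    where
    new : ∀ x → δ 0F x + (δ 2F x + b * (δ 0F x + δ 2F x)) ≤ suc b
    new 0F = count-new-line-present b 1 NP.≤-refl
    new 1F = count-new-line-absent b 0 z≤n
    new 2F = count-new-line-present b 1 NP.≤-refl
  row-count′ (suc (suc i)) x = count-old-line (λ ()) i x (row-count i x)
  column-count′ : ∀ j x → count (column c′ j) x ≤ suc a
  column-count′ 0F x rewrite ∑-alternate a (λ z → δ z x) 0F 2F = new x
    where
    new : ∀ x → δ 1F x + (δ 0F x + (δ 2F x + a * (δ 0F x + δ 2F x))) ≤ suc a
    new 0F = count-new-line-present a 1 NP.≤-refl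
    new 1F = count-new-line-absent a 1 (s≤s z≤n)
    new 2F = count-new-line-present a 1 NP.≤-refl
  column-count′ 1F x rewrite ∑-alternate a (λ z → δ z x) 2F 0F = new x
    where
    new : ∀ x → δ 1F x + (δ 2F x + (δ 0F x + a * (δ 2F x + δ 0F x))) ≤ suc a
    new 0F = count-new-line-present a 1 NP.≤-refl
    new 1F = count-new-line-absent a 1 (s≤s z≤n)
    new 2F = count-new-line-present a 1 NP.≤-refl
  column-count′ (suc (suc j)) x = count-old-line (λ ()) j x (column-count j x)

OddEvenInvariant⇒IsMajNSD : ∀ {a b c} → OddEvenInvariant a b c → IsMajNSD c
OddEvenInvariant⇒IsMajNSD {a} {b} inv = record
  { rows-balanced    = λ i x → 2*m≤double b (row-count i x)
  ; columns-balanced = λ j x → 2*m≤1+double a (column-count j x)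
  ; σ-distinct       = λ i j e → m*4≢2+n*4 b a (trans (sym (row-σ i)) (trans e (column-σ j)))
  }
  where open OddEvenInvariant inv

OddEvenInvariant-fromTable : ∀ a b (T : Vec (Vec (Fin 3) (double b)) (suc (double a))) →
  {True (all? λ i → σ (fromTable T i) ≟ℕ b * 4)} →
  {True (all? λ j → σ (column (fromTable T) j) ≟ℕ 2 + a * 4)} →
  {True (all? λ i → all? λ x → count (fromTable T i) x ≤? b)} →
  {True (all? λ j → all? λ x → count (column (fromTable T) j) x ≤? a)} →
  OddEvenInvariant a b (fromTable T)
OddEvenInvariant-fromTable a b T {rows} {columns} {row-counts} {column-counts} = record
  { row-σ = toWitness rows ; column-σ = toWitness columns
  ; row-count = toWitness row-counts ; column-count = toWitness column-counts }

oddEvenPlusOne : ∀ a → Σ (EdgeColoring (suc (double (1 + a))) (double (2 + a)) 3) (OddEvenInvariant (1 + a) (2 + a))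
oddEvenPlusOne zero = _ , OddEvenInvariant-fromTable 1 2
  ((1F ∷ 2F ∷ 1F ∷ 0F ∷ []) ∷
   (0F ∷ 0F ∷ 2F ∷ 2F ∷ []) ∷
   (2F ∷ 1F ∷ 0F ∷ 1F ∷ []) ∷ [])
oddEvenPlusOne (suc a) with oddEvenPlusOne a
... | c , inv = oddEvenBorder c , oddEvenBorder-invariant (1 + a) (2 + a) c (s≤s z≤n) inv

oddEvenMinusOne : ∀ a → Σ (EdgeColoring (suc (double (2 + a))) (double (2 + a)) 3) (OddEvenInvariant (2 + a) (2 + a))
oddEvenMinusOne zero = _ , OddEvenInvariant-fromTable 2 2
  ((1F ∷ 2F ∷ 1F ∷ 0F ∷ []) ∷
   (0F ∷ 0F ∷ 2F ∷ 2F ∷ []) ∷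
   (0F ∷ 2F ∷ 0F ∷ 2F ∷ []) ∷
   (2F ∷ 0F ∷ 2F ∷ 0F ∷ []) ∷
   (2F ∷ 1F ∷ 0F ∷ 1F ∷ []) ∷ [])
oddEvenMinusOne (suc a) with oddEvenMinusOne a
... | c , inv = oddEvenBorder c , oddEvenBorder-invariant (2 + a) (2 + a) c (s≤s z≤n) inv

OddEvenInvariant⇒HasMajNSD : ∀ {a b c} → OddEvenInvariant a b c → HasMajNSD (suc (double a)) (double b) 3
OddEvenInvariant⇒HasMajNSD inv = IsMajNSD⇒HasMajNSD (OddEvenInvariant⇒IsMajNSD inv)

-- The border gives the old first row and column two more edges of colour 1F.
record OddSquareInvariant a (c : EdgeColoring (suc (double a)) (suc (double a)) 3) : Set where
  field
    row-σ              : ∀ i → σ (c i) ≡ 2 + a * 4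
    column-σ           : ∀ j → σ (column c j) ≢ 2 + a * 4
    row-count          : ∀ i x → count (c i) x ≤ a
    column-count       : ∀ j x → count (column c j) x ≤ a
    first-row-count    : count (c 0F) 1F < a
    first-column-count : count (column c 0F) 1F < a

oddSquareBorder : ∀ {a} → EdgeColoring (suc (double a)) (suc (double a)) 3 →
                  EdgeColoring (suc (double (suc a))) (suc (double (suc a))) 3
oddSquareBorder c = border c (1F ◂ alternate 2F 0F) (1F ◂ alternate 0F 2F) (1F ◂ alternate 2F 0F) (1F ◂ alternate 0F 2F)
                             2F 0F 1F 1F

oddSquareBorder-invariant : ∀ a (c : EdgeColoring (suc (double a)) (suc (double a)) 3) → 2 ≤ a →
  OddSquareInvariant a c → OddSquareInvariant (suc a) (oddSquareBorder c)
oddSquareBorder-invariant a c 2≤a inv = record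
  { row-σ = row-σ′ ; column-σ = column-σ′ ; row-count = row-count′ ; column-count = column-count′
  ; first-row-count = first-row-count′ ; first-column-count = first-column-count′ }
  where
  open OddSquareInvariant inv
  c′ = oddSquareBorder c
  1≤a : 1 ≤ a
  1≤a = NP.≤-trans (s≤s z≤n) 2≤a
  row-σ′ : ∀ i → σ (c′ i) ≡ 2 + suc a * 4
  row-σ′ 0F = cong (λ z → 3 + (1 + (2 + z))) (∑-alternate a colourValue 2F 0F)
  row-σ′ 1F = cong (λ z → 2 + (2 + (2 + z))) (∑-alternate a colourValue 0F 2F)
  row-σ′ 2F = cong (λ z → 2 + (2 + z)) (row-σ 0F)
  row-σ′ (suc (suc (suc i))) = σ-old-line 2F 0F i (row-σ (suc i))
  column-σ′ : ∀ j → σ (column c′ j) ≢ 2 + suc a * 4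
  column-σ′ 0F e = m≢n⇒m+o≢n+o {7} {6} (a * 4) (λ ())
    (trans (sym (cong (λ z → 3 + (2 + (2 + z))) (∑-alternate a colourValue 2F 0F))) e)
  column-σ′ 1F e = m≢n⇒m+o≢n+o {5} {6} (a * 4) (λ ())
    (trans (sym (cong (λ z → 1 + (2 + (2 + z))) (∑-alternate a colourValue 0F 2F))) e)
  column-σ′ 2F e = column-σ 0F (NP.+-cancelˡ-≡ 4 _ _ e)
  column-σ′ (suc (suc (suc j))) e =
    column-σ (suc j) (NP.+-cancelˡ-≡ 4 _ _ (trans (sym (σ-old-line 2F 0F j refl)) e))
  row-count′ : ∀ i x → count (c′ i) x ≤ suc a
  row-count′ 0F x rewrite ∑-alternate a (λ z → δ z x) 2F 0F = new x
    where
    new : ∀ x → δ 2F x + (δ 0F x + (δ 1F x + a * (δ 2F x + δ 0F x))) ≤ suc a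
    new 0F = count-new-line-present a 1 NP.≤-refl
    new 1F = count-new-line-absent a 1 (s≤s z≤n)
    new 2F = count-new-line-present a 1 NP.≤-refl
  row-count′ 1F x rewrite ∑-alternate a (λ z → δ z x) 0F 2F = new x
    where
    new : ∀ x → δ 1F x + (δ 1F x + (δ 1F x + a * (δ 0F x + δ 2F x))) ≤ suc a
    new 0F = count-new-line-present a 0 z≤n
    new 1F = count-new-line-absent a 3 (s≤s 2≤a)
    new 2F = count-new-line-present a 0 z≤n
  row-count′ 2F 0F = NP.m≤n⇒m≤1+n (row-count 0F 0F)
  row-count′ 2F 1F = s≤s first-row-count
  row-count′ 2F 2F = NP.m≤n⇒m≤1+n (row-count 0F 2F)
  row-count′ (suc (suc (suc i))) x = count-old-line (λ ()) i x (row-count (suc i) x)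
  column-count′ : ∀ j x → count (column c′ j) x ≤ suc a
  column-count′ 0F x rewrite ∑-alternate a (λ z → δ z x) 2F 0F = new x
    where
    new : ∀ x → δ 2F x + (δ 1F x + (δ 1F x + a * (δ 2F x + δ 0F x))) ≤ suc a
    new 0F = count-new-line-present a 0 z≤n
    new 1F = count-new-line-absent a 2 (s≤s 1≤a)
    new 2F = count-new-line-present a 1 NP.≤-refl
  column-count′ 1F x rewrite ∑-alternate a (λ z → δ z x) 0F 2F = new x
    where
    new : ∀ x → δ 0F x + (δ 1F x + (δ 1F x + a * (δ 0F x + δ 2F x))) ≤ suc a
    new 0F = count-new-line-present a 1 NP.≤-refl
    new 1F = count-new-line-absent a 2 (s≤s 1≤a)
    new 2F = count-new-line-present a 0 z≤n
  column-count′ 2F 0F = NP.m≤n⇒m≤1+n (column-count 0F 0F)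
  column-count′ 2F 1F = s≤s first-column-count
  column-count′ 2F 2F = NP.m≤n⇒m≤1+n (column-count 0F 2F)
  column-count′ (suc (suc (suc j))) x = count-old-line (λ ()) j x (column-count (suc j) x)
  no-2F-alternating : count (alternate {double a} 2F 0F) 1F ≡ 0
  no-2F-alternating = trans (∑-alternate a (λ z → δ z 1F) 2F 0F) (NP.*-zeroʳ a)
  first-row-count′ : count (c′ 0F) 1F < suc a
  first-row-count′ = subst (λ z → 2 + z ≤ suc a) (sym no-2F-alternating) (s≤s 1≤a)
  first-column-count′ : count (column c′ 0F) 1F < suc a
  first-column-count′ = subst (λ z → 3 + z ≤ suc a) (sym no-2F-alternating) (s≤s 2≤a)

oddSquare-7 : EdgeColoring 7 7 3
oddSquare-7 = fromTable
  ((2F ∷ 0F ∷ 2F ∷ 2F ∷ 0F ∷ 0F ∷ 1F ∷ []) ∷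
   (0F ∷ 1F ∷ 2F ∷ 1F ∷ 0F ∷ 1F ∷ 2F ∷ []) ∷
   (0F ∷ 1F ∷ 2F ∷ 0F ∷ 1F ∷ 2F ∷ 1F ∷ []) ∷
   (2F ∷ 2F ∷ 0F ∷ 0F ∷ 1F ∷ 2F ∷ 0F ∷ []) ∷
   (2F ∷ 1F ∷ 1F ∷ 1F ∷ 2F ∷ 0F ∷ 0F ∷ []) ∷
   (1F ∷ 2F ∷ 1F ∷ 0F ∷ 1F ∷ 0F ∷ 2F ∷ []) ∷
   (1F ∷ 2F ∷ 0F ∷ 1F ∷ 0F ∷ 1F ∷ 2F ∷ []) ∷ [])

oddSquare-7-invariant : OddSquareInvariant 3 oddSquare-7
oddSquare-7-invariant = record
  { row-σ              = from-yes (all? λ i → σ (oddSquare-7 i) ≟ℕ 14)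
  ; column-σ           = from-yes (all? λ j → ¬? (σ (column oddSquare-7 j) ≟ℕ 14))
  ; row-count          = from-yes (all? λ i → all? λ x → count (oddSquare-7 i) x ≤? 3)
  ; column-count       = from-yes (all? λ j → all? λ x → count (column oddSquare-7 j) x ≤? 3)
  ; first-row-count    = from-yes (suc (count (oddSquare-7 0F) 1F) ≤? 3)
  ; first-column-count = from-yes (suc (count (column oddSquare-7 0F) 1F) ≤? 3)
  }

oddSquare : ∀ a → Σ (EdgeColoring (suc (double (3 + a))) (suc (double (3 + a))) 3) (OddSquareInvariant (3 + a))
oddSquare zero = oddSquare-7 , oddSquare-7-invariant
oddSquare (suc a) with oddSquare a
... | c , inv = oddSquareBorder c , oddSquareBorder-invariant (3 + a) c (s≤s (s≤s z≤n)) inv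

OddSquareInvariant⇒IsMajNSD : ∀ {a c} → OddSquareInvariant a c → IsMajNSD c
OddSquareInvariant⇒IsMajNSD {a} inv = record
  { rows-balanced    = λ i x → 2*m≤1+double a (row-count i x)
  ; columns-balanced = λ j x → 2*m≤1+double a (column-count j x)
  ; σ-distinct       = λ i j e → column-σ j (trans (sym e) (row-σ i))
  }
  where open OddSquareInvariant inv

hasMajNSD-oddSquare : ∀ a → HasMajNSD (suc (double (3 + a))) (suc (double (3 + a))) 3
hasMajNSD-oddSquare a = IsMajNSD⇒HasMajNSD (OddSquareInvariant⇒IsMajNSD (proj₂ (oddSquare a)))

-- Chessboard and cyclic colourings

alternate-balanced : ∀ {k} t {x y : Fin k} → x ≢ y → Balanced (alternate {double t} x y)
alternate-balanced t {x} {y} x≢y a rewrite ∑-alternate t (λ z → δ z a) x y =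
  2*m≤double t (NP.≤-trans (NP.*-monoʳ-≤ t (δ+δ≤1 a x≢y)) (NP.≤-reflexive (NP.*-identityʳ t)))

Balanced-resp-≗ : ∀ {d k} {f g : Line d k} → (∀ i → f i ≡ g i) → Balanced f → Balanced g
Balanced-resp-≗ {d} f≗g balanced a =
  subst (λ z → 2 * z ≤ d) (sum-cong-≗ (λ i → cong (λ z → δ z a) (f≗g i))) (balanced a)

σ-resp-≗ : ∀ {d k} {f g : Line d k} → (∀ i → f i ≡ g i) → σ f ≡ σ g
σ-resp-≗ f≗g = sum-cong-≗ (cong colourValue ∘ f≗g)

alternate-alternate : ∀ {n m k} (x y : Fin k) (i : Fin n) (j : Fin m) →
  alternate (alternate x y i) (alternate y x i) j ≡ alternate (alternate x y j) (alternate y x j) i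
alternate-alternate x y 0F j = refl
alternate-alternate x y (suc i) j = alternate-alternate y x i j

chessboard : ∀ {n m} → EdgeColoring n m 2
chessboard i = alternate (alternate 0F 1F i) (alternate 1F 0F i)

chessboard-IsMajNSD : ∀ p q → p ≢ q → IsMajNSD (chessboard {double p} {double q})
chessboard-IsMajNSD p q p≢q = record
  { rows-balanced    = λ i → alternate-balanced q (alternate-swap-≢ (λ ()) i)
  ; columns-balanced = λ j → Balanced-resp-≗ (λ i → sym (alternate-alternate {double p} {double q} {2} 0F 1F i j))
                                             (alternate-balanced p (alternate-swap-≢ (λ ()) j))
  ; σ-distinct       = λ i j e → p≢q (sym (NP.*-cancelʳ-≡ q p 3 (trans (sym (σ-row i)) (trans e (σ-column j)))))
  }
  where
  σ-row : ∀ i → σ (chessboard {double p} {double q} i) ≡ q * 3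
  σ-row i = trans (∑-alternate q colourValue (alternate 0F 1F i) (alternate 1F 0F i))
                  (cong (q *_) (alternate-swap-+ colourValue 0F 1F i))
  σ-column : ∀ j → σ (column (chessboard {double p} {double q}) j) ≡ p * 3
  σ-column j = begin
    σ (column (chessboard {double p} {double q}) j)   ≡⟨ σ-resp-≗ (λ i → alternate-alternate {double p} {double q} {2} 0F 1F i j) ⟩
    σ (alternate {double p} (alternate 0F 1F j) (alternate 1F 0F j))
      ≡⟨ ∑-alternate p colourValue (alternate 0F 1F j) (alternate 1F 0F j) ⟩
    p * (colourValue (alternate {double q} 0F 1F j) + colourValue (alternate {double q} 1F 0F j))
      ≡⟨ cong (p *_) (alternate-swap-+ colourValue 0F 1F j) ⟩
    p * 3 ∎
    where open ≡-Reasoning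

next : Fin 3 → Fin 3
next 0F = 1F
next 1F = 2F
next 2F = 0F

next³ : ∀ s → next (next (next s)) ≡ s
next³ 0F = refl
next³ 1F = refl
next³ 2F = refl

cyclic : ∀ {n} → Fin 3 → Line n 3
cyclic s 0F = s
cyclic s (suc j) = cyclic (next s) j

cyclic-next : ∀ {n} s (j : Fin n) → cyclic (next s) j ≡ next (cyclic s j)
cyclic-next s 0F = refl
cyclic-next s (suc j) = cyclic-next (next s) j

cyclic-cyclic : ∀ {n m} s (i : Fin n) (j : Fin m) → cyclic (cyclic s i) j ≡ cyclic (cyclic s j) i
cyclic-cyclic s 0F j = refl
cyclic-cyclic s (suc i) j = trans (cyclic-cyclic (next s) i j) (cong (λ z → cyclic z i) (cyclic-next s j))

∑-cyclic-+3 : ∀ d s (g : Fin 3 → ℕ) → ∑[ j < 3 + d ] g (cyclic s j) ≡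
  g s + (g (next s) + (g (next (next s)) + ∑[ j < d ] g (cyclic s j)))
∑-cyclic-+3 d s g = cong (λ z → g s + (g (next s) + (g (next (next s)) + ∑[ j < d ] g (cyclic z j)))) (next³ s)

σ-cyclic-+3 : ∀ d s → σ (cyclic {3 + d} s) ≡ 6 + σ (cyclic {d} s)
σ-cyclic-+3 d s = trans (∑-cyclic-+3 d s colourValue) (period s)
  where
  period : ∀ s → colourValue s + (colourValue (next s) + (colourValue (next (next s)) + σ (cyclic {d} s)))
                 ≡ 6 + σ (cyclic {d} s)
  period 0F = refl
  period 1F = refl
  period 2F = refl

count-cyclic-+3 : ∀ d s a → count (cyclic {3 + d} s) a ≡ suc (count (cyclic {d} s) a)
count-cyclic-+3 d s a = trans (∑-cyclic-+3 d s (λ z → δ z a)) (period s a)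
  where
  period : ∀ s a → δ s a + (δ (next s) a + (δ (next (next s)) a + count (cyclic {d} s) a))
                   ≡ suc (count (cyclic {d} s) a)
  period 0F 0F = refl
  period 0F 1F = refl
  period 0F 2F = refl
  period 1F 0F = refl
  period 1F 1F = refl
  period 1F 2F = refl
  period 2F 0F = refl
  period 2F 1F = refl
  period 2F 2F = refl

σ-cyclic-bounds : ∀ d s → double d ≤ suc (σ (cyclic {d} s)) × σ (cyclic {d} s) ≤ suc (double d)
σ-cyclic-bounds 0 s = z≤n , z≤n
σ-cyclic-bounds 1 s = from-yes (all? λ s → (2 ≤? suc (σ (cyclic {1} s))) ×-dec (σ (cyclic {1} s) ≤? 3)) s
σ-cyclic-bounds 2 s = from-yes (all? λ s → (4 ≤? suc (σ (cyclic {2} s))) ×-dec (σ (cyclic {2} s) ≤? 5)) s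
σ-cyclic-bounds (suc (suc (suc d))) s rewrite σ-cyclic-+3 d s with σ-cyclic-bounds d s
... | lower , upper = s≤s⁶ lower , s≤s⁶ upper
  where
  s≤s⁶ : ∀ {m n} → m ≤ n → 6 + m ≤ 6 + n
  s≤s⁶ = NP.+-monoʳ-≤ 6

cyclic-balanced : ∀ d s → 2 ≤ d → Balanced (cyclic {d} s)
cyclic-balanced 1 s (s≤s ())
cyclic-balanced 2 s _ = from-yes (all? λ s → balanced? (cyclic {2} s)) s
cyclic-balanced 3 s _ = from-yes (all? λ s → balanced? (cyclic {3} s)) s
cyclic-balanced 4 s _ = from-yes (all? λ s → balanced? (cyclic {4} s)) s
cyclic-balanced (suc (suc (suc (suc (suc d))))) s _ a =
  subst (λ z → 2 * z ≤ 5 + d) (sym (count-cyclic-+3 (2 + d) s a))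
        (two-more (cyclic-balanced (suc (suc d)) s (s≤s (s≤s z≤n)) a))
  where
  two-more : ∀ {c} → 2 * c ≤ 2 + d → 2 * suc c ≤ 5 + d
  two-more {c} le = subst (_≤ 5 + d) (sym (NP.*-suc 2 c)) (s≤s (s≤s (NP.m≤n⇒m≤1+n le)))

double-cancel-≤ : ∀ {m n} → double m ≤ double n → m ≤ n
double-cancel-≤ {zero} _ = z≤n
double-cancel-≤ {suc m} {suc n} (s≤s (s≤s le)) = s≤s (double-cancel-≤ le)

cyclicColouring : ∀ {n m} → EdgeColoring n m 3
cyclicColouring i = cyclic (cyclic 0F i)

cyclic-IsMajNSD : ∀ n m → 2 ≤ n → 2 + n ≤ m → IsMajNSD (cyclicColouring {n} {m})
cyclic-IsMajNSD n m 2≤n 2+n≤m = record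
  { rows-balanced    = λ i → cyclic-balanced m (cyclic 0F i) (NP.≤-trans 2≤n (NP.≤-trans (NP.m≤n+m n 2) 2+n≤m))
  ; columns-balanced = λ j → Balanced-resp-≗ (λ i → sym (cyclic-cyclic 0F i j)) (cyclic-balanced n (cyclic 0F j) 2≤n)
  ; σ-distinct       = λ i j e → NP.<⇒≱ 2+n≤m (double-cancel-≤ (begin
      double m                          ≤⟨ proj₁ (σ-cyclic-bounds m (cyclic 0F i)) ⟩
      suc (σ (cyclic {m} (cyclic 0F i))) ≡⟨ cong suc (trans e (σ-resp-≗ {f = column (cyclicColouring {n} {m}) j} (λ i′ → cyclic-cyclic 0F i′ j))) ⟩
      suc (σ (cyclic {n} (cyclic 0F j))) ≤⟨ s≤s (proj₂ (σ-cyclic-bounds n (cyclic 0F j))) ⟩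
      double (suc n)                    ∎))
  }
  where open NP.≤-Reasoning

2*≡double : ∀ t → 2 * t ≡ double t
2*≡double zero = refl
2*≡double (suc t) = cong suc (trans (NP.+-suc t (t + 0)) (cong suc (2*≡double t)))

⌊double/2⌋ : ∀ t → ⌊ double t /2⌋ ≡ t
⌊double/2⌋ zero = refl
⌊double/2⌋ (suc t) = cong suc (⌊double/2⌋ t)

⌊1+double/2⌋ : ∀ t → ⌊ suc (double t) /2⌋ ≡ t
⌊1+double/2⌋ zero = refl
⌊1+double/2⌋ (suc t) = cong suc (⌊1+double/2⌋ t)

Even⇒double : ∀ {n} → Even n → ∃ λ t → n ≡ double t
Even⇒double (t , n≡2t) = t , trans n≡2t (2*≡double t)

Odd⇒double : ∀ {n} → Odd n → ∃ λ t → n ≡ suc (double t)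
Odd⇒double (t , n≡1+2t) = t , trans n≡1+2t (cong suc (2*≡double t))

¬HasMajNSD-1 : ∀ n m → ¬ HasMajNSD (suc n) (suc m) 1
¬HasMajNSD-1 n m = ¬HasMajNSD-few-colours (subst (_< suc m) (sym (NP.*-identityˡ _)) (NP.⌊n/2⌋<n m))

¬HasMajNSD-2-oddColumns : ∀ n {m} → Odd m → ¬ HasMajNSD (suc n) m 2
¬HasMajNSD-2-oddColumns n odd with Odd⇒double odd
... | t , refl = ¬HasMajNSD-few-colours (subst (λ z → 2 * z < suc (double t)) (sym (⌊1+double/2⌋ t))
                                               (subst (_< suc (double t)) (sym (2*≡double t)) NP.≤-refl))

¬HasMajNSD-2 : ∀ n m → Odd (suc n) ⊎ Odd (suc m) → ¬ HasMajNSD (suc n) (suc m) 2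
¬HasMajNSD-2 n m (inj₁ odd) = ¬HasMajNSD-2-oddColumns m odd ∘ HasMajNSD-transpose
¬HasMajNSD-2 n m (inj₂ odd) = ¬HasMajNSD-2-oddColumns n odd

hasMajNSD-adjacent : ∀ n → 2 ≤ n → Odd n ⊎ Odd (suc n) → HasMajNSD n (suc n) 3
hasMajNSD-adjacent n 2≤n (inj₁ odd) with Odd⇒double odd
... | zero , refl = contradiction 2≤n λ { (s≤s ()) }
... | suc a , refl = OddEvenInvariant⇒HasMajNSD (proj₂ (oddEvenPlusOne a))
hasMajNSD-adjacent n 2≤n (inj₂ odd) with Odd⇒double odd
... | zero , refl = contradiction 2≤n λ ()
... | 1 , refl = HasMajNSD-transpose hasMajNSD-3-2-3
... | suc (suc a) , refl = HasMajNSD-transpose (OddEvenInvariant⇒HasMajNSD (proj₂ (oddEvenMinusOne a)))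

hasMajNSD-3-< : ∀ n m → 2 ≤ n → n < m → Odd n ⊎ Odd m → HasMajNSD n m 3
hasMajNSD-3-< n m 2≤n n<m odd with suc (suc n) ≤? m
... | yes 2+n≤m = IsMajNSD⇒HasMajNSD (cyclic-IsMajNSD n m 2≤n 2+n≤m)
... | no 2+n≰m with NP.≤-antisym n<m (NP.≤-pred (NP.≰⇒> 2+n≰m))
...   | refl = hasMajNSD-adjacent n 2≤n odd

hasMajNSD-n-n-3 : ∀ n → 2 ≤ n → Odd n → n ≢ 3 → n ≢ 5 → HasMajNSD n n 3
hasMajNSD-n-n-3 n 2≤n odd n≢3 n≢5 with Odd⇒double odd
... | 0 , refl = contradiction 2≤n λ { (s≤s ()) }
... | 1 , refl = contradiction refl n≢3
... | 2 , refl = contradiction refl n≢5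
... | suc (suc (suc a)) , refl = hasMajNSD-oddSquare a

hasMajNSD-3 : ∀ n m → 2 ≤ n → 2 ≤ m → Odd n ⊎ Odd m →
  ¬ (n ≡ 3 × m ≡ 3) → ¬ (n ≡ 5 × m ≡ 5) → HasMajNSD n m 3
hasMajNSD-3 n m 2≤n 2≤m odd not-3-3 not-5-5 with NP.<-cmp n m
... | tri< n<m _ _ = hasMajNSD-3-< n m 2≤n n<m odd
... | tri> _ _ m<n = HasMajNSD-transpose (hasMajNSD-3-< m n 2≤m m<n (swap odd))
... | tri≈ _ refl _ = hasMajNSD-n-n-3 n 2≤n (reduce odd)
                        (λ n≡3 → not-3-3 (n≡3 , n≡3)) (λ n≡5 → not-5-5 (n≡5 , n≡5))

χ-2-2 : ChiMSigma≡ 2 2 4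
χ-2-2 = ChiMSigma≡-intro hasMajNSD-2-2-4 (¬HasMajNSD-one-short {1} {3} refl)

χ-3-3 : ChiMSigma≡ 3 3 5
χ-3-3 = ChiMSigma≡-intro hasMajNSD-3-3-5 (¬HasMajNSD-one-short {2} {4} refl)

χ-5-5 : ChiMSigma≡ 5 5 4
χ-5-5 = ChiMSigma≡-intro hasMajNSD-5-5-4 (¬HasMajNSD-one-short {4} {3} refl)

χ-evenSquare : ∀ n → 4 ≤ n → Even n → ChiMSigma≡ n n 3
χ-evenSquare n 4≤n even with Even⇒double even
... | suc (suc t) , refl = ChiMSigma≡-intro (hasMajNSD-evenSquare t)
  (¬HasMajNSD-tight (sym (trans (cong (2 *_) (⌊double/2⌋ (2 + t))) (2*≡double (2 + t)))))
... | 0 , refl = contradiction 4≤n λ ()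
... | 1 , refl = contradiction 4≤n λ { (s≤s (s≤s ())) }

χ-evenRectangle : ∀ n m → 0 < n → 0 < m → Even n → Even m → n ≢ m → ChiMSigma≡ n m 2
χ-evenRectangle n m 0<n 0<m even-n even-m n≢m with Even⇒double even-n | Even⇒double even-m
... | suc t , refl | suc u , refl = ChiMSigma≡-intro
  (IsMajNSD⇒HasMajNSD (chessboard-IsMajNSD (suc t) (suc u) (n≢m ∘ cong double)))
  (¬HasMajNSD-1 _ _)

χ-odd : ∀ n m → 2 ≤ n → 2 ≤ m → Odd n ⊎ Odd m → ¬ (n ≡ 3 × m ≡ 3) → ¬ (n ≡ 5 × m ≡ 5) → ChiMSigma≡ n m 3
χ-odd (suc n) (suc m) 2≤n 2≤m odd not-3-3 not-5-5 =
  ChiMSigma≡-intro (hasMajNSD-3 _ _ 2≤n 2≤m odd not-3-3 not-5-5) (¬HasMajNSD-2 n m odd)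

ChiMSigma≡-at : ∀ {n m a b k} → n ≡ a → m ≡ b → ChiMSigma≡ a b k → ChiMSigma≡ n m k
ChiMSigma≡-at refl refl χ = χ

mainTheorem9 : ((n m : ℕ) → 0 < n → 0 < m → Even n → Even m →
    (n ≡ 2 → m ≡ 2 → ChiMSigma≡ n m 4) ×
    (n ≡ m → 4 ≤ n → ChiMSigma≡ n m 3) ×
    (n ≢ m → ChiMSigma≡ n m 2)) ×
    ((n m : ℕ) → 2 ≤ n → 2 ≤ m → Odd n ⊎ Odd m →
    (n ≡ 3 → m ≡ 3 → ChiMSigma≡ n m 5) ×
    (n ≡ 5 → m ≡ 5 → ChiMSigma≡ n m 4) ×
    (¬ (n ≡ 3 × m ≡ 3) → ¬ (n ≡ 5 × m ≡ 5) → ChiMSigma≡ n m 3))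
mainTheorem9 =
  (λ n m 0<n 0<m even-n even-m →
    (λ n≡2 m≡2 → ChiMSigma≡-at n≡2 m≡2 χ-2-2) ,
    (λ n≡m 4≤n → ChiMSigma≡-at refl (sym n≡m) (χ-evenSquare n 4≤n even-n)) ,
    χ-evenRectangle n m 0<n 0<m even-n even-m) ,
  (λ n m 2≤n 2≤m odd →
    (λ n≡3 m≡3 → ChiMSigma≡-at n≡3 m≡3 χ-3-3) ,
    (λ n≡5 m≡5 → ChiMSigma≡-at n≡5 m≡5 χ-5-5) ,
    χ-odd n m 2≤n 2≤m odd)
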